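{- Let $n \geq 2$, $p, m \in \mathbb{N}$ with $m \geq p$, and let $G_1,\ldots,G_n$ be vertex-disjoint graphs. For each $i \in [n]$ let $\{u_{i,1},\ldots,u_{i,p}\}$ be a clique in $G_i$, and let $G$ be obtained from the disjoint union of $G_1,\ldots,G_n$ by identifying $u_{1,q},\ldots,u_{n,q}$ as a single vertex $u_q$ for each $q \in [p]$. Suppose that for each $i \in [n]$, for every $m$-fold cover $\mathcal{D}_i=(K_i,D_i)$ of $G_i$ and every independent set $A$ of $D_i$ with $A \subseteq \bigcup_{q=1}^{p} K_i(u_{i,q})$ and $|A \cap K_i(u_{i,q})|=1$ for each $q \in [p]$, we have $N(A,\mathcal{D}_i) \geq P_{DP}(G_i,m)/\prod_{j=0}^{p-1}(m-j)$. Then \[ P_{DP}(G,m) \geq \frac{\prod_{i=1}^{n} P_{DP}(G_i,m)}{\left(\prod_{j=0}^{p-1}(m-j)\right)^{n-1}}. \]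
   Context: All graphs are finite and simple. A cover of a graph $G$ is a pair $\mathcal{H}=(L,H)$ where $H$ is a graph and $L: V(G) \to \mathcal{P}(V(H))$ satisfies: (1) $\{L(u): u \in V(G)\}$ is a partition of $V(H)$ into $|V(G)|$ parts; (2) $H[L(u)]$ is complete for each $u$; (3) if there is an edge of $H$ between $L(u)$ and $L(v)$ with $u \neq v$, then $uv \in E(G)$; (4) if $uv \in E(G)$, the edges of $H$ between $L(u)$ and $L(v)$ form a (possibly empty) matching. The cover is $m$-fold if $|L(u)|=m$ for all $u$. An $\mathcal{H}$-coloring of $G$ is an independent set of $H$ of size $|V(G)|$. $P_{DP}(G,m)$ is the minimum number of $\mathcal{H}$-colorings over all $m$-fold covers. For $S \subseteq V(H)$, $N(S,\mathcal{H})$ is the number of $\mathcal{H}$-colorings containing $S$. -}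

module Defs where

open import Data.Nat using (ℕ; zero; suc; _+_; _*_; _∸_; _≤_)
open import Data.Bool using (Bool; true; false; _∧_; _∨_; not)
open import Data.Fin using (Fin; zero; suc; toℕ; splitAt; _↑ˡ_; _↑ʳ_; _≟_)
open import Data.Fin.Base using ()
open import Data.Vec.Functional using () renaming (_∷_ to _∷ᶠ_)
open import Data.List using (List; map; concatMap; length; filterᵇ)
open import Data.List using (allFin) renaming ([_] to sing)
open import Data.Maybe using (Maybe; just; nothing)
open import Data.Product using (Σ; _,_; _×_)
open import Data.Sum using (inj₁; inj₂)
open import Relation.Nullary using (yes; no; ⌊_⌋)
open import Relation.Binary.PropositionalEquality using (_≡_; refl)
open import Function using (_∘_)

allF : ∀ {n} → (Fin n → Bool) → Bool
allF {zero}  f = true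
allF {suc n} f = f zero ∧ allF (f ∘ suc)

anyF : ∀ {n} → (Fin n → Bool) → Bool
anyF {zero}  f = false
anyF {suc n} f = f zero ∨ anyF (f ∘ suc)

sumF : ∀ {n} → (Fin n → ℕ) → ℕ
sumF {zero}  f = 0
sumF {suc n} f = f zero + sumF (f ∘ suc)

prodF : ∀ {n} → (Fin n → ℕ) → ℕ
prodF {zero}  f = 1
prodF {suc n} f = f zero * prodF (f ∘ suc)

fall : ℕ → ℕ → ℕ
fall m p = prodF {p} (λ j → m ∸ toℕ j)

-- Graphs: vertex set Fin k, adjacency given as a Boolean relation.
-- (Simplicity = symmetric + irreflexive, imposed as hypotheses.)

Adj : ℕ → Set
Adj k = Fin k → Fin k → Bool

-- An m-fold cover (L,H) of a graph on Fin k.  WLOG (up to isomorphism of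
-- covers, which preserves all counts) V(H) = Fin k × Fin m and
-- L(u) = {u} × Fin m.  Each L(u) is a clique (implicit); E lists the
-- edges of H between different lists.
record Cover {k : ℕ} (m : ℕ) (adj : Adj k) : Set where
  field
    E       : Fin k → Fin m → Fin k → Fin m → Bool
    E-sym   : ∀ u a v b → E u a v b ≡ E v b u a
    E-cross : ∀ u a b → E u a u b ≡ false
    E-adj   : ∀ u a v b → E u a v b ≡ true → adj u v ≡ true
    E-match : ∀ u a v b b' → E u a v b ≡ true → E u a v b' ≡ true → b ≡ b'
open Cover public

allFuns : (k m : ℕ) → List (Fin k → Fin m)
allFuns zero    m = sing (λ ())
allFuns (suc k) m = concatMap (λ a → map (λ f → a ∷ᶠ f) (allFuns k m)) (allFin m)

-- An H-coloring (independent set of H of size |V(G)|, i.e. one vertex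
-- of each L(u), pairwise non-adjacent) encoded as its choice function c.
isColoring : ∀ {k m} {adj : Adj k} → Cover m adj → (Fin k → Fin m) → Bool
isColoring D c = allF (λ u → allF (λ v → not (E D u (c u) v (c v))))

numColorings : ∀ {k m} {adj : Adj k} → Cover m adj → ℕ
numColorings {k} {m} D = length (filterᵇ (isColoring D) (allFuns k m))

IsPDP : ∀ {k} → Adj k → ℕ → ℕ → Set
IsPDP {k} adj m P =
  ((D : Cover m adj) → P ≤ numColorings D) × Σ (Cover m adj) (λ D → numColorings D ≡ P)

-- Graphs with a distinguished p-clique: vertex set Fin (p + r), the
-- clique vertices u_1..u_p being q ↑ˡ r (q : Fin p).

-- A = {(u_q, a q) : q ∈ [p]} ; A is an independent set of D
IndepOnClique : ∀ {p r m} {adj : Adj (p + r)} → Cover m adj → (Fin p → Fin m) → Set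
IndepOnClique {p} {r} D a =
  ∀ q q' → E D (q ↑ˡ r) (a q) (q' ↑ˡ r) (a q') ≡ false

N : ∀ {p r m} {adj : Adj (p + r)} → Cover m adj → (Fin p → Fin m) → ℕ
N {p} {r} {m} D a =
  length (filterᵇ (λ c → isColoring D c ∧ allF (λ q → ⌊ c (q ↑ˡ r) ≟ a q ⌋))
                  (allFuns (p + r) m))

-- Gluing G_1..G_n (G_i on Fin (p + r i)) along the cliques:
-- V(G) = Fin (p + sumF r); the first p vertices are u_1..u_p, the rest
-- are the non-clique vertices of G_1, ..., G_n in order.

decode : ∀ {n} (r : Fin n → ℕ) → Fin (sumF r) → Σ (Fin n) (λ i → Fin (r i))
decode {suc n} r x with splitAt (r zero) x
... | inj₁ y = zero , y
... | inj₂ z with decode (r ∘ suc) z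
...   | i , w = suc i , w

toLocal : ∀ {n} p (r : Fin n → ℕ) (i : Fin n) → Fin (p + sumF r) → Maybe (Fin (p + r i))
toLocal p r i x with splitAt p x
... | inj₁ q = just (q ↑ˡ r i)
... | inj₂ y with decode r y
...   | j , z with j ≟ i
...     | yes refl = just (p ↑ʳ z)
...     | no _ = nothing

localAdj : ∀ {k} → Adj k → Maybe (Fin k) → Maybe (Fin k) → Bool
localAdj adj (just x) (just y) = adj x y
localAdj adj _ _ = false

glueAdj : ∀ {n} p (r : Fin n → ℕ) → ((i : Fin n) → Adj (p + r i)) → Adj (p + sumF r)
glueAdj p r adj x y = anyF (λ i → localAdj (adj i) (toLocal p r i x) (toLocal p r i y))

-- Let D be an optimal m-fold cover of G and D_i its restriction to G_i. A map
-- that restricts to a D_i-colouring on every G_i is a D-colouring, since every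
-- edge of G lies in some G_i; so for each colouring a of the clique u_1..u_p the
-- D-colourings extending a number at least ∏ᵢ N(a, D_i). Colouring the clique
-- greedily, at least m(m-1)⋯(m-p+1) such a are independent in D, and for each
-- of them the hypothesis gives N(a, D_i) ≥ P_DP(G_i, m) / ∏ⱼ(m-j). Summing over
-- these a yields P_DP(G, m) ≥ ∏ⱼ(m-j) · ∏ᵢ P_DP(G_i, m) / (∏ⱼ(m-j))ⁿ.

{-# OPTIONS --safe #-}
module Submission where

open import Defs
open import Data.Nat using (ℕ; _≤_; _+_; _*_; _^_; _∸_)
open import Data.Bool using (Bool; true; false)
open import Data.Fin using (Fin; _↑ˡ_)
open import Relation.Binary.PropositionalEquality using (_≡_; _≢_)

open import Data.Nat using (zero; suc; z≤n; s≤s; _<_; >-nonZero)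
open import Data.Nat.Properties hiding (_≟_; suc-injective)
open import Data.Nat.ListAction using (sum)
open import Data.Nat.ListAction.Properties using (sum-++)
open import Data.Bool using (_∧_; not)
open import Data.Bool.Properties using (∧-conicalˡ; ∧-conicalʳ; not-injective)
open import Data.Fin using (zero; suc; toℕ; splitAt; _↑ʳ_; _≟_; inject₁; fromℕ)
open import Data.Fin.Properties
  using (splitAt-↑ˡ; splitAt-↑ʳ; splitAt⁻¹-↑ˡ; splitAt⁻¹-↑ʳ; toℕ<n; toℕ-inject₁; toℕ-fromℕ; suc-injective)
open import Data.Vec.Functional using () renaming (_∷_ to _∷ᶠ_)
open import Data.List using (List; []; _∷_; _++_; map; concatMap; length; filterᵇ; tabulate; allFin)
open import Data.List.Properties using (map-++; map-∘; map-tabulate)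
open import Data.Maybe using (just; nothing)
open import Data.Product using (Σ; _,_; proj₁; proj₂)
open import Data.Sum using (inj₁; inj₂; [_,_]′)
open import Relation.Nullary using (yes; no; ⌊_⌋; contradiction)
open import Relation.Binary.Core using (_Preserves_⟶_)
open import Relation.Binary.PropositionalEquality
  using (refl; sym; trans; cong; cong₂; subst; _≗_; module ≡-Reasoning)
open import Function using (_∘_)
open import Algebra.Properties.Semiring.Sum +-*-semiring
  using (sum-syntax; sum-cong-≗; ∑-distrib-+; ∑-comm; *-distribˡ-sum; *-distribʳ-sum)
open import Algebra.Properties.CommutativeSemigroup *-commutativeSemigroup
  using (interchange; x∙yz≈y∙xz)

𝟙 : Bool → ℕ
𝟙 true  = 1
𝟙 false = 0

𝟙-∧ : ∀ a b → 𝟙 (a ∧ b) ≡ 𝟙 a * 𝟙 b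
𝟙-∧ true  b = sym (+-identityʳ (𝟙 b))
𝟙-∧ false b = refl

𝟙-mono : ∀ {a b} → (a ≡ true → b ≡ true) → 𝟙 a ≤ 𝟙 b
𝟙-mono {true}  a⇒b rewrite a⇒b refl = ≤-refl
𝟙-mono {false} _ = z≤n

𝟙*𝟙≤𝟙 : ∀ {a b c} → (a ≡ true → b ≡ true → c ≡ true) → 𝟙 a * 𝟙 b ≤ 𝟙 c
𝟙*𝟙≤𝟙 {a} {b} a∧b⇒c = subst (_≤ _) (𝟙-∧ a b) (𝟙-mono λ ab → a∧b⇒c (∧-conicalˡ a b ab) (∧-conicalʳ a b ab))

length-filterᵇ : ∀ {A : Set} (f : A → Bool) xs → length (filterᵇ f xs) ≡ sum (map (𝟙 ∘ f) xs)
length-filterᵇ f []       = refl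
length-filterᵇ f (x ∷ xs) with f x
... | true  = cong suc (length-filterᵇ f xs)
... | false = length-filterᵇ f xs

allF⁺ : ∀ {n} (f : Fin n → Bool) → (∀ i → f i ≡ true) → allF f ≡ true
allF⁺ {zero}  f _ = refl
allF⁺ {suc n} f all rewrite all zero = allF⁺ (f ∘ suc) (all ∘ suc)

allF⁻ : ∀ {n} (f : Fin n → Bool) → allF f ≡ true → ∀ i → f i ≡ true
allF⁻ {suc n} f all zero    = ∧-conicalˡ (f zero) _ all
allF⁻ {suc n} f all (suc i) = allF⁻ (f ∘ suc) (∧-conicalʳ (f zero) _ all) i

allF-cong : ∀ {n} {f g : Fin n → Bool} → f ≗ g → allF f ≡ allF g
allF-cong {zero}  _   = refl
allF-cong {suc n} f≗g = cong₂ _∧_ (f≗g zero) (allF-cong (f≗g ∘ suc))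

anyF⁻ : ∀ {n} (f : Fin n → Bool) → anyF f ≡ true → Σ (Fin n) (λ i → f i ≡ true)
anyF⁻ {suc n} f any with f zero in f0
... | true  = zero , f0
... | false with anyF⁻ (f ∘ suc) any
...   | i , fi = suc i , fi

∑-mono-≤ : ∀ {n} {f g : Fin n → ℕ} → (∀ i → f i ≤ g i) → ∑[ i < n ] f i ≤ ∑[ i < n ] g i
∑-mono-≤ {zero}  _   = z≤n
∑-mono-≤ {suc n} f≤g = +-mono-≤ (f≤g zero) (∑-mono-≤ (f≤g ∘ suc))

∑-const : ∀ n c → ∑[ i < n ] c ≡ n * c
∑-const zero    c = refl
∑-const (suc n) c = cong (c +_) (∑-const n c)

∑-𝟙-≟ : ∀ {n} (h : Fin n → ℕ) y → ∑[ x < n ] (𝟙 ⌊ x ≟ y ⌋ * h x) ≡ h y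
∑-𝟙-≟ {suc n} h zero =
  trans (cong (h zero + 0 +_) (trans (∑-const n 0) (*-zeroʳ n))) (trans (+-identityʳ _) (+-identityʳ _))
∑-𝟙-≟ {suc n} h (suc y) = trans (sum-cong-≗ {n} λ x → cong (λ b → 𝟙 b * h (suc x)) (suc-≟-suc x y)) (∑-𝟙-≟ (h ∘ suc) y)
  where
  suc-≟-suc : ∀ {n} (x y : Fin n) → ⌊ suc x ≟ suc y ⌋ ≡ ⌊ x ≟ y ⌋
  suc-≟-suc x y with x ≟ y
  ... | yes _ = refl
  ... | no  _ = refl

∑-𝟙-unique≤1 : ∀ {n} (f : Fin n → Bool) → (∀ x y → f x ≡ true → f y ≡ true → x ≡ y) → ∑[ x < n ] 𝟙 (f x) ≤ 1
∑-𝟙-unique≤1 {zero}  f _ = z≤n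
∑-𝟙-unique≤1 {suc n} f unique with f zero in f0
... | true  = s≤s (≤-reflexive (trans (sum-cong-≗ {n} (cong 𝟙 ∘ rest-false)) (trans (∑-const n 0) (*-zeroʳ n))))
  where
  rest-false : ∀ x → f (suc x) ≡ false
  rest-false x with f (suc x) in fx
  ... | false = refl
  ... | true with unique zero (suc x) f0 fx
  ...   | ()
... | false = ∑-𝟙-unique≤1 (f ∘ suc) (λ x y fx fy → suc-injective (unique (suc x) (suc y) fx fy))

1≤𝟙-allF-not+∑𝟙 : ∀ {n} (f : Fin n → Bool) → 1 ≤ 𝟙 (allF (not ∘ f)) + ∑[ i < n ] 𝟙 (f i)
1≤𝟙-allF-not+∑𝟙 {zero}  f = ≤-refl
1≤𝟙-allF-not+∑𝟙 {suc n} f with f zero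
... | true  = s≤s z≤n
... | false = 1≤𝟙-allF-not+∑𝟙 (f ∘ suc)

sum-tabulate : ∀ {n} (f : Fin n → ℕ) → sum (tabulate f) ≡ ∑[ i < n ] f i
sum-tabulate {zero}  f = refl
sum-tabulate {suc n} f = cong (f zero +_) (sum-tabulate (f ∘ suc))

sum-map-concatMap : ∀ {A B : Set} (g : B → ℕ) (h : A → List B) xs →
  sum (map g (concatMap h xs)) ≡ sum (map (λ x → sum (map g (h x))) xs)
sum-map-concatMap g h []       = refl
sum-map-concatMap g h (x ∷ xs) = begin
  sum (map g (h x ++ concatMap h xs))                ≡⟨ cong sum (map-++ g (h x) _) ⟩
  sum (map g (h x) ++ map g (concatMap h xs))        ≡⟨ sum-++ (map g (h x)) _ ⟩
  sum (map g (h x)) + sum (map g (concatMap h xs))   ≡⟨ cong (sum (map g (h x)) +_) (sum-map-concatMap g h xs) ⟩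
  sum (map g (h x)) + sum (map (λ x → sum (map g (h x))) xs) ∎
  where open ≡-Reasoning

prodF-cong : ∀ {n} {f g : Fin n → ℕ} → f ≗ g → prodF f ≡ prodF g
prodF-cong {zero}  _   = refl
prodF-cong {suc n} f≗g = cong₂ _*_ (f≗g zero) (prodF-cong (f≗g ∘ suc))

prodF-mono-≤ : ∀ {n} {f g : Fin n → ℕ} → (∀ i → f i ≤ g i) → prodF f ≤ prodF g
prodF-mono-≤ {zero}  _   = ≤-refl
prodF-mono-≤ {suc n} f≤g = *-mono-≤ (f≤g zero) (prodF-mono-≤ (f≤g ∘ suc))

prodF-*-const : ∀ {n} (f : Fin n → ℕ) c → prodF (λ i → f i * c) ≡ prodF f * c ^ n
prodF-*-const {zero}  f c = refl
prodF-*-const {suc n} f c =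
  trans (cong (f zero * c *_) (prodF-*-const (f ∘ suc) c)) (interchange (f zero) c (prodF (f ∘ suc)) (c ^ n))

prodF-𝟙 : ∀ {n} (f : Fin n → Bool) → prodF (𝟙 ∘ f) ≡ 𝟙 (allF f)
prodF-𝟙 {zero}  f = refl
prodF-𝟙 {suc n} f = trans (cong (𝟙 (f zero) *_) (prodF-𝟙 (f ∘ suc))) (sym (𝟙-∧ (f zero) _))

prodF-init-last : ∀ n (f : Fin (suc n) → ℕ) → prodF f ≡ prodF (f ∘ inject₁) * f (fromℕ n)
prodF-init-last zero    f = trans (*-identityʳ _) (sym (+-identityʳ _))
prodF-init-last (suc n) f = trans (cong (f zero *_) (prodF-init-last n (f ∘ suc))) (sym (*-assoc (f zero) _ _))

prodF-pos : ∀ {n} (f : Fin n → ℕ) → (∀ i → 0 < f i) → 0 < prodF f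
prodF-pos {zero}  f _   = s≤s z≤n
prodF-pos {suc n} f pos = *-mono-< (pos zero) (prodF-pos (f ∘ suc) (pos ∘ suc))

fall-suc : ∀ m p → fall m (suc p) ≡ fall m p * (m ∸ p)
fall-suc m p = trans (prodF-init-last p (λ j → m ∸ toℕ j))
  (cong₂ _*_ (prodF-cong {p} (cong (m ∸_) ∘ toℕ-inject₁)) (cong (m ∸_) (toℕ-fromℕ p)))

fall-pos : ∀ {m p} → p ≤ m → 0 < fall m p
fall-pos p≤m = prodF-pos _ (λ j → m<n⇒0<n∸m (≤-trans (toℕ<n j) p≤m))

module _ {m : ℕ} where

  ∑ₐ : (k : ℕ) → ((Fin k → Fin m) → ℕ) → ℕ
  ∑ₐ zero    g = g (λ ())
  ∑ₐ (suc k) g = ∑[ x < m ] ∑ₐ k (λ a → g (x ∷ᶠ a))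

  ∑ₐ-cong : ∀ k {f g : (Fin k → Fin m) → ℕ} → (∀ a → f a ≡ g a) → ∑ₐ k f ≡ ∑ₐ k g
  ∑ₐ-cong zero    f≡g = f≡g _
  ∑ₐ-cong (suc k) f≡g = sum-cong-≗ {m} λ x → ∑ₐ-cong k λ a → f≡g (x ∷ᶠ a)

  ∑ₐ-mono-≤ : ∀ k {f g : (Fin k → Fin m) → ℕ} → (∀ a → f a ≤ g a) → ∑ₐ k f ≤ ∑ₐ k g
  ∑ₐ-mono-≤ zero    f≤g = f≤g _
  ∑ₐ-mono-≤ (suc k) f≤g = ∑-mono-≤ λ x → ∑ₐ-mono-≤ k λ a → f≤g (x ∷ᶠ a)

  ∑ₐ-*ˡ : ∀ k c (f : (Fin k → Fin m) → ℕ) → ∑ₐ k (λ a → c * f a) ≡ c * ∑ₐ k f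
  ∑ₐ-*ˡ zero    c f = refl
  ∑ₐ-*ˡ (suc k) c f = trans (sum-cong-≗ {m} λ x → ∑ₐ-*ˡ k c _) (sym (*-distribˡ-sum c (λ x → ∑ₐ k (λ a → f (x ∷ᶠ a)))))

  ∑ₐ-*ʳ : ∀ k c (f : (Fin k → Fin m) → ℕ) → ∑ₐ k (λ a → f a * c) ≡ ∑ₐ k f * c
  ∑ₐ-*ʳ k c f = trans (∑ₐ-cong k λ a → *-comm (f a) c) (trans (∑ₐ-*ˡ k c f) (*-comm c _))

  ∑ₐ-∑-comm : ∀ k {n} (f : (Fin k → Fin m) → Fin n → ℕ) →
    ∑ₐ k (λ a → ∑[ j < n ] f a j) ≡ ∑[ j < n ] ∑ₐ k (λ a → f a j)
  ∑ₐ-∑-comm zero    f = refl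
  ∑ₐ-∑-comm (suc k) f = trans (sum-cong-≗ {m} λ x → ∑ₐ-∑-comm k (f ∘ (x ∷ᶠ_))) (∑-comm (λ x j → ∑ₐ k (λ a → f (x ∷ᶠ a) j)))

  infixr 5 _++ᵃ_
  _++ᵃ_ : ∀ {k l} → (Fin k → Fin m) → (Fin l → Fin m) → Fin (k + l) → Fin m
  _++ᵃ_ {zero}  a b = b
  _++ᵃ_ {suc k} a b = a zero ∷ᶠ (a ∘ suc) ++ᵃ b

  ++ᵃ-↑ˡ : ∀ {k l} (a : Fin k → Fin m) (b : Fin l → Fin m) q → (a ++ᵃ b) (q ↑ˡ l) ≡ a q
  ++ᵃ-↑ˡ a b zero    = refl
  ++ᵃ-↑ˡ a b (suc q) = ++ᵃ-↑ˡ (a ∘ suc) b q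

  ++ᵃ-↑ʳ : ∀ {k l} (a : Fin k → Fin m) (b : Fin l → Fin m) z → (a ++ᵃ b) (k ↑ʳ z) ≡ b z
  ++ᵃ-↑ʳ {zero}  a b z = refl
  ++ᵃ-↑ʳ {suc k} a b z = ++ᵃ-↑ʳ (a ∘ suc) b z

  ++ᵃ-cong : ∀ {k l} {a a' : Fin k → Fin m} {b b' : Fin l → Fin m} → a ≗ a' → b ≗ b' → a ++ᵃ b ≗ a' ++ᵃ b'
  ++ᵃ-cong {zero}  a≗a' b≗b' x       = b≗b' x
  ++ᵃ-cong {suc k} a≗a' b≗b' zero    = a≗a' zero
  ++ᵃ-cong {suc k} a≗a' b≗b' (suc x) = ++ᵃ-cong (a≗a' ∘ suc) b≗b' x

  ∑ₐ-++ᵃ : ∀ k l (g : (Fin (k + l) → Fin m) → ℕ) → ∑ₐ (k + l) g ≡ ∑ₐ k (λ a → ∑ₐ l (λ b → g (a ++ᵃ b)))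
  ∑ₐ-++ᵃ zero    l g = refl
  ∑ₐ-++ᵃ (suc k) l g = sum-cong-≗ {m} λ x → ∑ₐ-++ᵃ k l (λ c → g (x ∷ᶠ c))

  sum-map-allFuns : ∀ k (g : (Fin k → Fin m) → ℕ) → sum (map g (allFuns k m)) ≡ ∑ₐ k g
  sum-map-allFuns zero    g = +-identityʳ _
  sum-map-allFuns (suc k) g = begin
    sum (map g (concatMap (λ x → map (x ∷ᶠ_) (allFuns k m)) (allFin m)))
      ≡⟨ sum-map-concatMap g _ (allFin m) ⟩
    sum (map (λ x → sum (map g (map (x ∷ᶠ_) (allFuns k m)))) (allFin m))
      ≡⟨ cong sum (map-tabulate {n = m} (λ x → x) (λ x → sum (map g (map (x ∷ᶠ_) (allFuns k m))))) ⟩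
    sum (tabulate (λ x → sum (map g (map (x ∷ᶠ_) (allFuns k m)))))
      ≡⟨ sum-tabulate (λ x → sum (map g (map (x ∷ᶠ_) (allFuns k m)))) ⟩
    ∑[ x < m ] sum (map g (map (x ∷ᶠ_) (allFuns k m)))
      ≡⟨ sum-cong-≗ {m} (λ x → trans (cong sum (sym (map-∘ {g = g} {f = x ∷ᶠ_} (allFuns k m)))) (sum-map-allFuns k _)) ⟩
    ∑ₐ (suc k) g ∎
    where open ≡-Reasoning

  _≟ᵃ_ : ∀ {k} → (Fin k → Fin m) → (Fin k → Fin m) → Bool
  a' ≟ᵃ a = allF (λ q → ⌊ a' q ≟ a q ⌋)

  ∑ₐ-𝟙-≟ᵃ : ∀ k (G : (Fin k → Fin m) → ℕ) → G Preserves _≗_ ⟶ _≡_ →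
    ∀ a → ∑ₐ k (λ a' → 𝟙 (a' ≟ᵃ a) * G a') ≡ G a
  ∑ₐ-𝟙-≟ᵃ zero    G G-ext a = trans (+-identityʳ _) (G-ext λ ())
  ∑ₐ-𝟙-≟ᵃ (suc k) G G-ext a = begin
    ∑[ x < m ] ∑ₐ k (λ f → 𝟙 (⌊ x ≟ a zero ⌋ ∧ (f ≟ᵃ (a ∘ suc))) * G (x ∷ᶠ f))
      ≡⟨ sum-cong-≗ {m} (λ x → ∑ₐ-cong k λ f → trans (cong (_* G (x ∷ᶠ f)) (𝟙-∧ ⌊ x ≟ a zero ⌋ _)) (*-assoc (𝟙 ⌊ x ≟ a zero ⌋) _ _)) ⟩
    ∑[ x < m ] ∑ₐ k (λ f → 𝟙 ⌊ x ≟ a zero ⌋ * (𝟙 (f ≟ᵃ (a ∘ suc)) * G (x ∷ᶠ f)))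
      ≡⟨ sum-cong-≗ {m} (λ x → trans (∑ₐ-*ˡ k (𝟙 ⌊ x ≟ a zero ⌋) _) (cong (𝟙 ⌊ x ≟ a zero ⌋ *_) (∑ₐ-𝟙-≟ᵃ k _ (G-ext ∘ cons-cong x) (a ∘ suc)))) ⟩
    ∑[ x < m ] (𝟙 ⌊ x ≟ a zero ⌋ * G (x ∷ᶠ a ∘ suc))
      ≡⟨ ∑-𝟙-≟ _ (a zero) ⟩
    G (a zero ∷ᶠ a ∘ suc)
      ≡⟨ G-ext (λ { zero → refl ; (suc q) → refl }) ⟩
    G a ∎
    where
    open ≡-Reasoning
    cons-cong : ∀ x {f g : Fin k → Fin m} → f ≗ g → x ∷ᶠ f ≗ x ∷ᶠ g
    cons-cong x f≗g zero    = refl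
    cons-cong x f≗g (suc i) = f≗g i

isColoring⁺ : ∀ {k m} {adj : Adj k} (D : Cover m adj) c →
  (∀ u v → E D u (c u) v (c v) ≡ false) → isColoring D c ≡ true
isColoring⁺ D c no-edge = allF⁺ _ λ u → allF⁺ _ λ v → cong not (no-edge u v)

isColoring⁻ : ∀ {k m} {adj : Adj k} (D : Cover m adj) c →
  isColoring D c ≡ true → ∀ u v → E D u (c u) v (c v) ≡ false
isColoring⁻ D c col u v = not-injective (allF⁻ _ (allF⁻ _ col u) v)

isColoring-cong : ∀ {k m} {adj : Adj k} (D : Cover m adj) {c c'} → c ≗ c' → isColoring D c ≡ isColoring D c'
isColoring-cong D c≗c' = allF-cong λ u → allF-cong λ v → cong not (cong₂ (λ x y → E D u x v y) (c≗c' u) (c≗c' v))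

numColorings≡∑ₐ : ∀ {k m} {adj : Adj k} (D : Cover m adj) → numColorings D ≡ ∑ₐ k (𝟙 ∘ isColoring D)
numColorings≡∑ₐ {k} {m} D = trans (length-filterᵇ (isColoring D) (allFuns k m)) (sum-map-allFuns k _)

N≡∑ₐ-extensions : ∀ {p r m} {adj : Adj (p + r)} (D : Cover m adj) a →
  N D a ≡ ∑ₐ r (λ b → 𝟙 (isColoring D (a ++ᵃ b)))
N≡∑ₐ-extensions {p} {r} {m} D a = begin
  N D a
    ≡⟨ trans (length-filterᵇ extends (allFuns (p + r) m)) (sum-map-allFuns (p + r) (𝟙 ∘ extends)) ⟩
  ∑ₐ (p + r) (𝟙 ∘ extends)
    ≡⟨ ∑ₐ-++ᵃ p r (𝟙 ∘ extends) ⟩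
  ∑ₐ p (λ a' → ∑ₐ r (λ b → 𝟙 (extends (a' ++ᵃ b))))
    ≡⟨ ∑ₐ-cong p (λ a' → trans (∑ₐ-cong r (𝟙-extends a')) (∑ₐ-*ˡ r (𝟙 (a' ≟ᵃ a)) _)) ⟩
  ∑ₐ p (λ a' → 𝟙 (a' ≟ᵃ a) * extensions a')
    ≡⟨ ∑ₐ-𝟙-≟ᵃ p extensions extensions-cong a ⟩
  extensions a ∎
  where
  open ≡-Reasoning
  extends : (Fin (p + r) → Fin m) → Bool
  extends c = isColoring D c ∧ allF (λ q → ⌊ c (q ↑ˡ r) ≟ a q ⌋)
  extensions : (Fin p → Fin m) → ℕ
  extensions a' = ∑ₐ r (λ b → 𝟙 (isColoring D (a' ++ᵃ b)))
  𝟙-extends : ∀ a' b → 𝟙 (extends (a' ++ᵃ b)) ≡ 𝟙 (a' ≟ᵃ a) * 𝟙 (isColoring D (a' ++ᵃ b))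
  𝟙-extends a' b = begin
    𝟙 (extends (a' ++ᵃ b))
      ≡⟨ 𝟙-∧ (isColoring D (a' ++ᵃ b)) _ ⟩
    𝟙 (isColoring D (a' ++ᵃ b)) * 𝟙 (allF (λ q → ⌊ (a' ++ᵃ b) (q ↑ˡ r) ≟ a q ⌋))
      ≡⟨ cong (λ t → 𝟙 (isColoring D (a' ++ᵃ b)) * 𝟙 t) (allF-cong λ q → cong (λ y → ⌊ y ≟ a q ⌋) (++ᵃ-↑ˡ a' b q)) ⟩
    𝟙 (isColoring D (a' ++ᵃ b)) * 𝟙 (a' ≟ᵃ a)
      ≡⟨ *-comm (𝟙 (isColoring D (a' ++ᵃ b))) (𝟙 (a' ≟ᵃ a)) ⟩
    𝟙 (a' ≟ᵃ a) * 𝟙 (isColoring D (a' ++ᵃ b)) ∎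
  extensions-cong : extensions Preserves _≗_ ⟶ _≡_
  extensions-cong a≗a' = ∑ₐ-cong r λ b → cong 𝟙 (isColoring-cong D (++ᵃ-cong a≗a' λ _ → refl))

pullback : ∀ {j k m} {adj : Adj k} (f : Fin j → Fin k) → Cover m adj → Cover m (λ u v → adj (f u) (f v))
pullback f D = record
  { E       = λ u a v b → E D (f u) a (f v) b
  ; E-sym   = λ u a v b → E-sym D (f u) a (f v) b
  ; E-cross = λ u a b → E-cross D (f u) a b
  ; E-adj   = λ u a v b → E-adj D (f u) a (f v) b
  ; E-match = λ u a v b b' → E-match D (f u) a (f v) b b'
  }

module _ {p m : ℕ} {adj : Adj (suc p)} (D : Cover m adj) where

  freeAt : Fin m → (Fin p → Fin m) → Bool
  freeAt x a = allF (λ q → not (E D zero x (suc q) (a q)))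

  -- Each vertex suc q rules out at most one colour of vertex zero, as the
  -- edges between L(zero) and L(suc q) form a matching.
  m∸p≤∑-freeAt : ∀ a → m ∸ p ≤ ∑[ x < m ] 𝟙 (freeAt x a)
  m∸p≤∑-freeAt a = m≤n+o⇒m∸n≤o m p (begin
    m
      ≡⟨ sym (trans (∑-const m 1) (*-identityʳ m)) ⟩
    ∑[ x < m ] 1
      ≤⟨ ∑-mono-≤ (λ x → 1≤𝟙-allF-not+∑𝟙 (clash x)) ⟩
    ∑[ x < m ] (𝟙 (freeAt x a) + ∑[ q < p ] 𝟙 (clash x q))
      ≡⟨ ∑-distrib-+ (λ x → 𝟙 (freeAt x a)) _ ⟩
    free + ∑[ x < m ] ∑[ q < p ] 𝟙 (clash x q)
      ≡⟨ cong (free +_) (∑-comm (λ x q → 𝟙 (clash x q))) ⟩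
    free + ∑[ q < p ] ∑[ x < m ] 𝟙 (clash x q)
      ≤⟨ +-monoʳ-≤ free (∑-mono-≤ λ q → ∑-𝟙-unique≤1 (λ x → clash x q) (clash-unique q)) ⟩
    free + ∑[ q < p ] 1
      ≡⟨ trans (cong (free +_) (trans (∑-const p 1) (*-identityʳ p))) (+-comm free p) ⟩
    p + free ∎)
    where
    open ≤-Reasoning
    free : ℕ
    free = ∑[ x < m ] 𝟙 (freeAt x a)
    clash : Fin m → Fin p → Bool
    clash x q = E D zero x (suc q) (a q)
    clash-unique : ∀ q x y → clash x q ≡ true → clash y q ≡ true → x ≡ y
    clash-unique q x y x-clash y-clash = E-match D (suc q) (a q) zero x y
      (trans (E-sym D (suc q) (a q) zero x) x-clash) (trans (E-sym D (suc q) (a q) zero y) y-clash)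

  isColoring-∷ : ∀ x a → freeAt x a ≡ true → isColoring (pullback suc D) a ≡ true → isColoring D (x ∷ᶠ a) ≡ true
  isColoring-∷ x a free col = isColoring⁺ D (x ∷ᶠ a) no-edge
    where
    no-edge : ∀ u v → E D u ((x ∷ᶠ a) u) v ((x ∷ᶠ a) v) ≡ false
    no-edge zero    zero     = E-cross D zero x x
    no-edge zero    (suc q)  = not-injective (allF⁻ _ free q)
    no-edge (suc q) zero     = trans (E-sym D (suc q) (a q) zero x) (not-injective (allF⁻ _ free q))
    no-edge (suc q) (suc q') = isColoring⁻ (pullback suc D) a col q q'

fall≤∑ₐ-colorings : ∀ {p m} {adj : Adj p} (D : Cover m adj) → fall m p ≤ ∑ₐ p (𝟙 ∘ isColoring D)
fall≤∑ₐ-colorings {zero} D = ≤-refl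
fall≤∑ₐ-colorings {suc p} {m} {adj} D = begin
  fall m (suc p)
    ≡⟨ trans (fall-suc m p) (*-comm (fall m p) (m ∸ p)) ⟩
  (m ∸ p) * fall m p
    ≤⟨ *-monoʳ-≤ (m ∸ p) (fall≤∑ₐ-colorings D') ⟩
  (m ∸ p) * ∑ₐ p (𝟙 ∘ isColoring D')
    ≡⟨ sym (∑ₐ-*ˡ p (m ∸ p) (𝟙 ∘ isColoring D')) ⟩
  ∑ₐ p (λ a → (m ∸ p) * 𝟙 (isColoring D' a))
    ≤⟨ ∑ₐ-mono-≤ p (λ a → *-monoˡ-≤ (𝟙 (isColoring D' a)) (m∸p≤∑-freeAt D a)) ⟩
  ∑ₐ p (λ a → (∑[ x < m ] 𝟙 (freeAt D x a)) * 𝟙 (isColoring D' a))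
    ≡⟨ ∑ₐ-cong p (λ a → *-distribʳ-sum (𝟙 (isColoring D' a)) (λ x → 𝟙 (freeAt D x a))) ⟩
  ∑ₐ p (λ a → ∑[ x < m ] (𝟙 (freeAt D x a) * 𝟙 (isColoring D' a)))
    ≡⟨ ∑ₐ-∑-comm p (λ a x → 𝟙 (freeAt D x a) * 𝟙 (isColoring D' a)) ⟩
  ∑[ x < m ] ∑ₐ p (λ a → 𝟙 (freeAt D x a) * 𝟙 (isColoring D' a))
    ≤⟨ ∑-mono-≤ (λ x → ∑ₐ-mono-≤ p (λ a → 𝟙*𝟙≤𝟙 (isColoring-∷ D x a))) ⟩
  ∑ₐ (suc p) (𝟙 ∘ isColoring D) ∎
  where
  open ≤-Reasoning
  D' : Cover m (λ u v → adj (suc u) (suc v))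
  D' = pullback suc D

↑-ext : ∀ {A : Set} {p k} {f g : Fin (p + k) → A} →
  (∀ q → f (q ↑ˡ k) ≡ g (q ↑ˡ k)) → (∀ z → f (p ↑ʳ z) ≡ g (p ↑ʳ z)) → f ≗ g
↑-ext {p = zero}  left right x       = right x
↑-ext {p = suc p} left right zero    = left zero
↑-ext {p = suc p} {f = f} {g} left right (suc x) = ↑-ext {f = f ∘ suc} {g ∘ suc} (left ∘ suc) right x

encode : ∀ {n} (r : Fin n → ℕ) (i : Fin n) → Fin (r i) → Fin (sumF r)
encode r zero    z = z ↑ˡ sumF (r ∘ suc)
encode r (suc i) z = r zero ↑ʳ encode (r ∘ suc) i z

encode-decode : ∀ {n} (r : Fin n → ℕ) y → encode r (proj₁ (decode r y)) (proj₂ (decode r y)) ≡ y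
encode-decode {suc n} r y with splitAt (r zero) y in eq
... | inj₁ z = splitAt⁻¹-↑ˡ eq
... | inj₂ z with decode (r ∘ suc) z | encode-decode (r ∘ suc) z
...   | i , w | encode-decode-z = trans (cong (r zero ↑ʳ_) encode-decode-z) (splitAt⁻¹-↑ʳ eq)

embed : ∀ {n} p (r : Fin n → ℕ) i → Fin (p + r i) → Fin (p + sumF r)
embed p r i x = [ (_↑ˡ sumF r) , (λ z → p ↑ʳ encode r i z) ]′ (splitAt p x)

embed-↑ˡ : ∀ {n} p (r : Fin n → ℕ) i q → embed p r i (q ↑ˡ r i) ≡ q ↑ˡ sumF r
embed-↑ˡ p r i q rewrite splitAt-↑ˡ p q (r i) = refl

embed-↑ʳ : ∀ {n} p (r : Fin n → ℕ) i z → embed p r i (p ↑ʳ z) ≡ p ↑ʳ encode r i z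
embed-↑ʳ p r i z rewrite splitAt-↑ʳ p (r i) z = refl

embed-toLocal : ∀ {n} p (r : Fin n → ℕ) i x x' → toLocal p r i x ≡ just x' → embed p r i x' ≡ x
embed-toLocal p r i x x' eq with splitAt p x in eq₁
embed-toLocal p r i x .(q ↑ˡ r i) refl | inj₁ q = trans (embed-↑ˡ p r i q) (splitAt⁻¹-↑ˡ eq₁)
... | inj₂ y with decode r y in eq₂
...   | j , z with j ≟ i
embed-toLocal p r i x .(p ↑ʳ z) refl | inj₂ y | j , z | yes refl = begin
  embed p r i (p ↑ʳ z)  ≡⟨ embed-↑ʳ p r i z ⟩
  p ↑ʳ encode r j z     ≡⟨ cong (p ↑ʳ_) (subst (λ d → encode r (proj₁ d) (proj₂ d) ≡ y) eq₂ (encode-decode r y)) ⟩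
  p ↑ʳ y                ≡⟨ splitAt⁻¹-↑ʳ eq₁ ⟩
  x                     ∎
  where open ≡-Reasoning
embed-toLocal p r i x x' () | inj₂ y | j , z | no _

++ᵃ-∘-embed : ∀ {n m} p (r : Fin n → ℕ) i (a : Fin p → Fin m) (b : Fin (sumF r) → Fin m) →
  (a ++ᵃ b) ∘ embed p r i ≗ a ++ᵃ (b ∘ encode r i)
++ᵃ-∘-embed p r i a b = ↑-ext
  (λ q → trans (cong (a ++ᵃ b) (embed-↑ˡ p r i q)) (trans (++ᵃ-↑ˡ a b q) (sym (++ᵃ-↑ˡ a _ q))))
  (λ z → trans (cong (a ++ᵃ b) (embed-↑ʳ p r i z)) (trans (++ᵃ-↑ʳ a b (encode r i z)) (sym (++ᵃ-↑ʳ a _ z))))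

∑ₐ-prodF-blocks : ∀ {n m} (r : Fin n → ℕ) (h : (i : Fin n) → (Fin (r i) → Fin m) → ℕ) →
  (∀ i → h i Preserves _≗_ ⟶ _≡_) →
  ∑ₐ (sumF r) (λ b → prodF (λ i → h i (b ∘ encode r i))) ≡ prodF (λ i → ∑ₐ (r i) (h i))
∑ₐ-prodF-blocks {zero}  r h h-ext = refl
∑ₐ-prodF-blocks {suc n} {m} r h h-ext = begin
  ∑ₐ (r zero + S) G
    ≡⟨ ∑ₐ-++ᵃ (r zero) S G ⟩
  ∑ₐ (r zero) (λ a → ∑ₐ S (λ b → G (a ++ᵃ b)))
    ≡⟨ ∑ₐ-cong (r zero) (λ a → ∑ₐ-cong S (G-++ᵃ a)) ⟩
  ∑ₐ (r zero) (λ a → ∑ₐ S (λ b → h zero a * prodF (λ i → h (suc i) (b ∘ encode (r ∘ suc) i))))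
    ≡⟨ ∑ₐ-cong (r zero) (λ a → trans (∑ₐ-*ˡ S (h zero a) _)
         (cong (h zero a *_) (∑ₐ-prodF-blocks (r ∘ suc) (h ∘ suc) (h-ext ∘ suc)))) ⟩
  ∑ₐ (r zero) (λ a → h zero a * prodF (λ i → ∑ₐ (r (suc i)) (h (suc i))))
    ≡⟨ ∑ₐ-*ʳ (r zero) _ (h zero) ⟩
  prodF (λ i → ∑ₐ (r i) (h i)) ∎
  where
  open ≡-Reasoning
  S : ℕ
  S = sumF (r ∘ suc)
  G : (Fin (sumF r) → Fin m) → ℕ
  G b = prodF (λ i → h i (b ∘ encode r i))
  G-++ᵃ : ∀ a b → G (a ++ᵃ b) ≡ h zero a * prodF (λ i → h (suc i) (b ∘ encode (r ∘ suc) i))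
  G-++ᵃ a b = cong₂ _*_ (h-ext zero (++ᵃ-↑ˡ a b))
    (prodF-cong λ i → h-ext (suc i) (++ᵃ-↑ʳ a b ∘ encode (r ∘ suc) i))

module Gluing {n p m : ℕ} {r : Fin n → ℕ} {adj : (i : Fin n) → Adj (p + r i)}
               (adj-sym : ∀ i x y → adj i x y ≡ adj i y x) (D : Cover m (glueAdj p r adj)) where

  -- Intersecting with adj i is needed for condition (3): two clique vertices
  -- may be adjacent in G only through another G_j.
  localCover : (i : Fin n) → Cover m (adj i)
  localCover i = record
    { E       = λ u a v b → E D (embed p r i u) a (embed p r i v) b ∧ adj i u v
    ; E-sym   = λ u a v b → cong₂ _∧_ (E-sym D (embed p r i u) a (embed p r i v) b) (adj-sym i u v)
    ; E-cross = λ u a b → cong (_∧ adj i u u) (E-cross D (embed p r i u) a b)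
    ; E-adj   = λ u a v b uv → ∧-conicalʳ _ _ uv
    ; E-match = λ u a v b b' uv uv' →
        E-match D (embed p r i u) a (embed p r i v) b b' (∧-conicalˡ _ _ uv) (∧-conicalˡ _ _ uv')
    }

  cliqueCover : Cover m (λ q q' → glueAdj p r adj (q ↑ˡ sumF r) (q' ↑ˡ sumF r))
  cliqueCover = pullback (_↑ˡ sumF r) D

  isColoring-glued : ∀ c → (∀ i → isColoring (localCover i) (c ∘ embed p r i) ≡ true) → isColoring D c ≡ true
  isColoring-glued c local = isColoring⁺ D c no-edge
    where
    no-edge : ∀ u v → E D u (c u) v (c v) ≡ false
    no-edge u v with E D u (c u) v (c v) in uv
    ... | false = refl
    ... | true with anyF⁻ _ (E-adj D u (c u) v (c v) uv)
    ...   | i , uv-in-Gᵢ with toLocal p r i u in eu | toLocal p r i v in ev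
    ...     | nothing | _       = contradiction uv-in-Gᵢ λ ()
    ...     | just _  | nothing = contradiction uv-in-Gᵢ λ ()
    ...     | just u' | just v' with embed-toLocal p r i u u' eu | embed-toLocal p r i v v' ev
    ...       | refl | refl = contradiction
                (trans (sym (isColoring⁻ (localCover i) (c ∘ embed p r i) (local i) u' v')) (cong₂ _∧_ uv uv-in-Gᵢ))
                λ ()

  ∑ₐ-prodF-N≤numColorings : ∑ₐ p (λ a → prodF (λ i → N (localCover i) a)) ≤ numColorings D
  ∑ₐ-prodF-N≤numColorings = begin
    ∑ₐ p (λ a → prodF (λ i → N (localCover i) a))
      ≡⟨ ∑ₐ-cong p (λ a → trans (prodF-cong (λ i → N≡∑ₐ-extensions (localCover i) a))
           (sym (∑ₐ-prodF-blocks r (λ i b → 𝟙 (col i (a ++ᵃ b))) (λ i → col-cong i ∘ ++ᵃ-cong λ _ → refl)))) ⟩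
    ∑ₐ p (λ a → ∑ₐ S (λ b → prodF (λ i → 𝟙 (col i (a ++ᵃ (b ∘ encode r i))))))
      ≡⟨ ∑ₐ-cong p (λ a → ∑ₐ-cong S (λ b → prodF-cong (λ i → col-cong i (++ᵃ-∘-embed p r i a b)))) ⟨
    ∑ₐ p (λ a → ∑ₐ S (λ b → prodF (λ i → 𝟙 (col i ((a ++ᵃ b) ∘ embed p r i)))))
      ≡⟨ ∑ₐ-++ᵃ p S (λ c → prodF (λ i → 𝟙 (col i (c ∘ embed p r i)))) ⟨
    ∑ₐ (p + S) (λ c → prodF (λ i → 𝟙 (col i (c ∘ embed p r i))))
      ≤⟨ ∑ₐ-mono-≤ (p + S) (λ c → subst (_≤ _) (sym (prodF-𝟙 (λ i → col i (c ∘ embed p r i)))) (𝟙-mono (isColoring-glued c ∘ allF⁻ _))) ⟩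
    ∑ₐ (p + S) (𝟙 ∘ isColoring D)
      ≡⟨ numColorings≡∑ₐ D ⟨
    numColorings D ∎
    where
    open ≤-Reasoning
    S : ℕ
    S = sumF r
    col : (i : Fin n) → (Fin (p + r i) → Fin m) → Bool
    col i = isColoring (localCover i)
    col-cong : ∀ i {c c'} → c ≗ c' → 𝟙 (col i c) ≡ 𝟙 (col i c')
    col-cong i = cong 𝟙 ∘ isColoring-cong (localCover i)

  IndepOnClique-localCover : ∀ i a → isColoring cliqueCover a ≡ true → IndepOnClique (localCover i) a
  IndepOnClique-localCover i a col q q' = trans
    (cong₂ (λ u v → E D u (a q) v (a q') ∧ adj i (q ↑ˡ r i) (q' ↑ˡ r i)) (embed-↑ˡ p r i q) (embed-↑ˡ p r i q'))
    (cong (_∧ adj i (q ↑ˡ r i) (q' ↑ˡ r i)) (isColoring⁻ cliqueCover a col q q'))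

  fall*prodF≤numColorings*fall^n : (P : Fin n → ℕ) →
    (∀ i a → IndepOnClique (localCover i) a → P i ≤ N (localCover i) a * fall m p) →
    fall m p * prodF P ≤ numColorings D * fall m p ^ n
  fall*prodF≤numColorings*fall^n P P≤N*fall = begin
    fl * prodF P
      ≤⟨ *-monoˡ-≤ (prodF P) (fall≤∑ₐ-colorings cliqueCover) ⟩
    ∑ₐ p (𝟙 ∘ isColoring cliqueCover) * prodF P
      ≡⟨ ∑ₐ-*ʳ p (prodF P) (𝟙 ∘ isColoring cliqueCover) ⟨
    ∑ₐ p (λ a → 𝟙 (isColoring cliqueCover a) * prodF P)
      ≤⟨ ∑ₐ-mono-≤ p bound-at ⟩
    ∑ₐ p (λ a → prodF (λ i → N (localCover i) a * fl))
      ≡⟨ ∑ₐ-cong p (λ a → prodF-*-const (λ i → N (localCover i) a) fl) ⟩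
    ∑ₐ p (λ a → prodF (λ i → N (localCover i) a) * fl ^ n)
      ≡⟨ ∑ₐ-*ʳ p (fl ^ n) (λ a → prodF (λ i → N (localCover i) a)) ⟩
    ∑ₐ p (λ a → prodF (λ i → N (localCover i) a)) * fl ^ n
      ≤⟨ *-monoˡ-≤ (fl ^ n) ∑ₐ-prodF-N≤numColorings ⟩
    numColorings D * fl ^ n ∎
    where
    open ≤-Reasoning
    fl : ℕ
    fl = fall m p
    bound-at : ∀ a → 𝟙 (isColoring cliqueCover a) * prodF P ≤ prodF (λ i → N (localCover i) a * fl)
    bound-at a with isColoring cliqueCover a in col
    ... | false = z≤n
    ... | true  = subst (_≤ _) (sym (+-identityʳ (prodF P)))
                    (prodF-mono-≤ λ i → P≤N*fall i a (IndepOnClique-localCover i a col))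

corollary3p4 : (n p m : ℕ) → 2 ≤ n → p ≤ m →
    (r : Fin n → ℕ) (adj : (i : Fin n) → Adj (p + r i)) →
    (∀ i x y → adj i x y ≡ adj i y x) →
    (∀ i x → adj i x x ≡ false) →
    (∀ i q q' → q ≢ q' → adj i (q ↑ˡ r i) (q' ↑ˡ r i) ≡ true) →
    (P : Fin n → ℕ) → (∀ i → IsPDP (adj i) m (P i)) →
    (∀ i (D : Cover m (adj i)) (a : Fin p → Fin m) → IndepOnClique D a →
      P i ≤ N D a * fall m p) →
    (PG : ℕ) → IsPDP (glueAdj p r adj) m PG →
    prodF P ≤ PG * fall m p ^ (n ∸ 1)
corollary3p4 zero p m ()
corollary3p4 (suc n) p m _ p≤m r adj adj-sym _ _ P _ P≤N*fall PG (_ , D , D-optimal) =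
  *-cancelˡ-≤ fl {{>-nonZero (fall-pos p≤m)}} (begin
    fl * prodF P
      ≤⟨ fall*prodF≤numColorings*fall^n P (λ i → P≤N*fall i (localCover i)) ⟩
    numColorings D * (fl * fl ^ n)
      ≡⟨ cong (_* (fl * fl ^ n)) D-optimal ⟩
    PG * (fl * fl ^ n)
      ≡⟨ x∙yz≈y∙xz PG fl (fl ^ n) ⟩
    fl * (PG * fl ^ n) ∎)
  where
  open ≤-Reasoning
  open Gluing {p = p} {r = r} adj-sym D
  fl : ℕ
  fl = fall m p
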